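{- For every integer $n=2^k$ with $k\ge 2$, there exists an $(n/4,\,2\log_2 n)$-Ruzsa–Szemerédi graph on $n$ vertices.
   Context: All graphs are finite and simple. A matching $M$ in a graph $G$ is an induced matching if the subgraph of $G$ induced on the set of vertices covered by $M$ has edge set exactly $M$. A graph $G$ is an $(r,t)$-Ruzsa–Szemerédi graph if its edge set can be partitioned into $t$ pairwise edge-disjoint induced matchings, each consisting of exactly $r$ edges. -}

module Defs where

open import Data.Nat using (ℕ)
open import Data.Fin using (Fin)
open import Data.Bool using (Bool; true; false)
open import Data.Product using (Σ; ∃; _×_; _,_; proj₁; proj₂)
open import Data.Sum using (_⊎_)
open import Relation.Binary.PropositionalEquality using (_≡_)
open import Relation.Nullary using (¬_)

record Graph (n : ℕ) : Set where
  field
    adj   : Fin n → Fin n → Bool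
    sym   : ∀ u v → adj u v ≡ adj v u
    irrefl : ∀ v → adj v v ≡ false
open Graph public

-- An edge is represented by an ordered pair of endpoints; two pairs
-- denote the same (unordered) edge iff they agree up to swapping.
Pair : ℕ → Set
Pair n = Fin n × Fin n

SameEdge : ∀ {n} → Pair n → Pair n → Set
SameEdge (u , v) (u' , v') = (u ≡ u' × v ≡ v') ⊎ (u ≡ v' × v ≡ u')

IsEdge : ∀ {n} → Graph n → Pair n → Set
IsEdge G (u , v) = adj G u v ≡ true

Covers : ∀ {n} → Pair n → Fin n → Set
Covers (u , v) x = (x ≡ u) ⊎ (x ≡ v)

-- M (a family of r edges indexed by Fin r) is an induced matching of G with
-- exactly r edges: all are edges of G, distinct indices give vertex-disjoint
-- edges (so in particular r distinct edges), and every edge of G between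
-- two vertices covered by M is one of the edges of M.
IsInducedMatching : ∀ {n r} → Graph n → (Fin r → Pair n) → Set
IsInducedMatching {n} {r} G M =
  (∀ j → IsEdge G (M j))
  × (∀ j j' x → Covers (M j) x → Covers (M j') x → j ≡ j')
  × (∀ x y → (∃ λ j → Covers (M j) x) → (∃ λ j → Covers (M j) y) →
       IsEdge G (x , y) → ∃ λ j → SameEdge (x , y) (M j))

IsRuzsaSzemeredi : ∀ {n} → ℕ → ℕ → Graph n → Set
IsRuzsaSzemeredi {n} r t G =
  Σ (Fin t → Fin r → Pair n) λ M →
    (∀ i → IsInducedMatching G (M i))
    × (∀ i i' j j' → SameEdge (M i j) (M i' j') → (i ≡ i') × (j ≡ j'))
    × (∀ u v → IsEdge G (u , v) → ∃ λ i → ∃ λ j → SameEdge (u , v) (M i j))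

module Submission where

-- Vertices are bit vectors x ∈ {0,1}^k; x and y are adjacent when y is x
-- with one coordinate d flipped (a d-edge).  Cut the d-edges by the
-- "label" of an edge: the parity of either endpoint with coordinate d
-- cleared.  For each direction d and label b this gives a matching
-- M(b,d) of 2^(k-2) edges, and the 2k matchings partition the edges.
-- M(b,d) is induced: an edge between two covered vertices that is not a
-- d-edge flips some other coordinate j, and hence flips the label, so its
-- endpoints cannot both carry label b.

open import Defs hiding (sym)
open import Data.Nat using (ℕ; _≤_; _^_; _*_; _/_; zero; suc; s≤s)
open import Data.Nat.Properties using (*-comm; *-assoc)
open import Data.Nat.DivMod using (m*n/n≡m)
open import Data.Product using (Σ; ∃; _×_; _,_; map)
open import Data.Product.Function.NonDependent.Propositional using (_×-↔_)
open import Data.Sum using (_⊎_; inj₁; inj₂)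
open import Data.Bool using (Bool; true; false; not; _xor_)
open import Data.Bool.Properties using (_≟_; not-involutive; not-¬; xor-assoc; xor-comm; xor-same; xor-identityʳ; not-distribˡ-xor; not-distribʳ-xor)
open import Data.Fin using (Fin; zero; suc)
open import Data.Fin.Properties using (any?; 2↔Bool; *↔×) renaming (_≟_ to _≟ᶠ_)
open import Data.Vec using (Vec; []; _∷_; lookup; tail; updateAt; insertAt; removeAt; _[_]≔_)
open import Data.Vec.Properties using (≡-dec; ∷-injectiveʳ; lookup∘updateAt; lookup∘updateAt′; updateAt-updateAt; updateAt-cong; updateAt-id; updateAt-id-local; updateAt-commutes; insertAt-lookup; removeAt-insertAt; insertAt-removeAt)
open import Function using (_∘_)
open import Function.Bundles using (Inverse; _↔_; mk↔ₛ′)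
open import Function.Construct.Composition using (_↔-∘_)
open import Function.Construct.Identity using (↔-id)
open import Function.Construct.Symmetry using (↔-sym)
open import Relation.Nullary using (¬_; Dec; yes; no; does)
open import Relation.Nullary.Decidable using (dec-true; dec-false)
open import Relation.Binary.PropositionalEquality using (_≡_; _≢_; refl; sym; trans; cong; cong₂; subst; module ≡-Reasoning)
open ≡-Reasoning

record GraphOn (V : Set) : Set where
  field
    adjOn        : V → V → Bool
    adjOn-sym    : ∀ u v → adjOn u v ≡ adjOn v u
    adjOn-irrefl : ∀ v → adjOn v v ≡ false
open GraphOn

SameEdgeOn : ∀ {V : Set} → V × V → V × V → Set
SameEdgeOn (u , v) (u' , v') = (u ≡ u' × v ≡ v') ⊎ (u ≡ v' × v ≡ u')

CoversOn : ∀ {V : Set} → V × V → V → Set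
CoversOn (u , v) x = (x ≡ u) ⊎ (x ≡ v)

IsEdgeOn : ∀ {V : Set} → GraphOn V → V × V → Set
IsEdgeOn G (u , v) = adjOn G u v ≡ true

IsInducedMatchingOn : ∀ {V R : Set} → GraphOn V → (R → V × V) → Set
IsInducedMatchingOn G M =
  (∀ j → IsEdgeOn G (M j))
  × (∀ j j' x → CoversOn (M j) x → CoversOn (M j') x → j ≡ j')
  × (∀ x y → (∃ λ j → CoversOn (M j) x) → (∃ λ j → CoversOn (M j) y) →
       IsEdgeOn G (x , y) → ∃ λ j → SameEdgeOn (x , y) (M j))

IsRSOn : ∀ {V : Set} → (R T : Set) → GraphOn V → Set
IsRSOn {V} R T G =
  Σ (T → R → V × V) λ M →
    (∀ i → IsInducedMatchingOn G (M i))
    × (∀ i i' j j' → SameEdgeOn (M i j) (M i' j') → (i ≡ i') × (j ≡ j'))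
    × (∀ u v → IsEdgeOn G (u , v) → ∃ λ i → ∃ λ j → SameEdgeOn (u , v) (M i j))

from-injective : ∀ {A B : Set} (φ : A ↔ B) {y y'} →
                 Inverse.from φ y ≡ Inverse.from φ y' → y ≡ y'
from-injective φ {y} {y'} eq =
  trans (sym (strictlyInverseˡ y)) (trans (cong to eq) (strictlyInverseˡ y'))
  where open Inverse φ

to-injective : ∀ {A B : Set} (φ : A ↔ B) {x x'} →
               Inverse.to φ x ≡ Inverse.to φ x' → x ≡ x'
to-injective φ = from-injective (↔-sym φ)

reindex : ∀ {V R R' T T' : Set} {G : GraphOn V} →
          T ↔ T' → R ↔ R' → IsRSOn R T G → IsRSOn R' T' G
reindex {V} {R' = R'} {T' = T'} {G = G} α β (M , induced , disjoint , covering) =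
  M' , induced' , disjoint' , covering'
  where
  open Inverse
  M' : T' → R' → V × V
  M' i j = M (from α i) (from β j)

  retract : ∀ i j → M (from α (to α i)) (from β (to β j)) ≡ M i j
  retract i j = cong₂ M (strictlyInverseʳ α i) (strictlyInverseʳ β j)

  induced' : ∀ i → IsInducedMatchingOn G (M' i)
  induced' i with induced (from α i)
  ... | edges , vertexDisjoint , closed =
    (λ j → edges (from β j))
    , (λ j j' x c c' → from-injective β (vertexDisjoint _ _ x c c'))
    , λ x y (j , c) (j' , c') e →
        let (j₀ , s) = closed x y (from β j , c) (from β j' , c') e
        in to β j₀ , subst (SameEdgeOn (x , y)) (sym (cong (M (from α i)) (strictlyInverseʳ β j₀))) s

  disjoint' : ∀ i i' j j' → SameEdgeOn (M' i j) (M' i' j') → (i ≡ i') × (j ≡ j')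
  disjoint' i i' j j' s =
    map (from-injective α) (from-injective β) (disjoint _ _ _ _ s)

  covering' : ∀ u v → IsEdgeOn G (u , v) → ∃ λ i → ∃ λ j → SameEdgeOn (u , v) (M' i j)
  covering' u v e with covering u v e
  ... | i , j , s = to α i , to β j , subst (SameEdgeOn (u , v)) (sym (retract i j)) s

module Relabel {V : Set} {n : ℕ} (φ : V ↔ Fin n) where
  open Inverse φ

  relabelGraph : GraphOn V → Graph n
  relabelGraph G = record
    { adj    = λ a b → adjOn G (from a) (from b)
    ; sym    = λ a b → adjOn-sym G (from a) (from b)
    ; irrefl = λ a → adjOn-irrefl G (from a) }

  relabelPair : V × V → Pair n
  relabelPair = map to to

  edge-relabel : ∀ G e → IsEdgeOn G e → IsEdge (relabelGraph G) (relabelPair e)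
  edge-relabel G (u , v) e rewrite strictlyInverseʳ u | strictlyInverseʳ v = e

  covers-unlabel : ∀ e a → Covers (relabelPair e) a → CoversOn e (from a)
  covers-unlabel (u , v) a (inj₁ refl) = inj₁ (strictlyInverseʳ u)
  covers-unlabel (u , v) a (inj₂ refl) = inj₂ (strictlyInverseʳ v)

  same-unlabel : ∀ e e' → SameEdge (relabelPair e) (relabelPair e') → SameEdgeOn e e'
  same-unlabel e e' (inj₁ (p , q)) = inj₁ (to-injective φ p , to-injective φ q)
  same-unlabel e e' (inj₂ (p , q)) = inj₂ (to-injective φ p , to-injective φ q)

  from≡⇒≡to : ∀ a {u} → from a ≡ u → a ≡ to u
  from≡⇒≡to a p = trans (sym (strictlyInverseˡ a)) (cong to p)

  same-relabel : ∀ a b e → SameEdgeOn (from a , from b) e → SameEdge (a , b) (relabelPair e)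
  same-relabel a b e (inj₁ (p , q)) = inj₁ (from≡⇒≡to a p , from≡⇒≡to b q)
  same-relabel a b e (inj₂ (p , q)) = inj₂ (from≡⇒≡to a p , from≡⇒≡to b q)

  relabel : ∀ {r t} (G : GraphOn V) → IsRSOn (Fin r) (Fin t) G →
            Σ (Graph n) (IsRuzsaSzemeredi r t)
  relabel {r} {t} G (M , induced , disjoint , covering) =
    relabelGraph G , M' , induced' , disjoint' , covering'
    where
    M' : Fin t → Fin r → Pair n
    M' i j = relabelPair (M i j)

    induced' : ∀ i → IsInducedMatching (relabelGraph G) (M' i)
    induced' i with induced i
    ... | edges , vertexDisjoint , closed =
      (λ j → edge-relabel G (M i j) (edges j))
      , (λ j j' a c c' → vertexDisjoint j j' (from a)
                           (covers-unlabel _ a c) (covers-unlabel _ a c'))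
      , λ a b (j , c) (j' , c') e →
          let (j₀ , s) = closed (from a) (from b) (j , covers-unlabel _ a c)
                           (j' , covers-unlabel _ b c') e
          in j₀ , same-relabel a b (M i j₀) s

    disjoint' : ∀ i i' j j' → SameEdge (M' i j) (M' i' j') → (i ≡ i') × (j ≡ j')
    disjoint' i i' j j' s = disjoint i i' j j' (same-unlabel _ _ s)

    covering' : ∀ a b → IsEdge (relabelGraph G) (a , b) →
                ∃ λ i → ∃ λ j → SameEdge (a , b) (M' i j)
    covering' a b e with covering (from a) (from b) e
    ... | i , j , s = i , j , same-relabel a b (M i j) s

open Relabel using (relabel)

flip : ∀ {k} → Fin k → Vec Bool k → Vec Bool k
flip d x = updateAt x d not

flip-involutive : ∀ {k} (d : Fin k) x → flip d (flip d x) ≡ x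
flip-involutive d x = begin
  updateAt (updateAt x d not) d not ≡⟨ updateAt-updateAt d x ⟩
  updateAt x d (not ∘ not)          ≡⟨ updateAt-cong d not-involutive x ⟩
  updateAt x d (λ b → b)            ≡⟨ updateAt-id d x ⟩
  x                                 ∎

flip-changes : ∀ {k} (d : Fin k) x → flip d x ≢ x
flip-changes d x eq = not-¬ refl (begin
  lookup x d          ≡⟨ cong (λ y → lookup y d) (sym eq) ⟩
  lookup (flip d x) d ≡⟨ lookup∘updateAt d x ⟩
  not (lookup x d)    ∎)

flip-direction-injective : ∀ {k} (d d' : Fin k) x → flip d x ≡ flip d' x → d ≡ d'
flip-direction-injective d d' x eq with d ≟ᶠ d'
... | yes d≡d' = d≡d'
... | no d≢d' with () ← not-¬ refl (begin
  lookup x d           ≡⟨ lookup∘updateAt′ d d' d≢d' x ⟨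
  lookup (flip d' x) d ≡⟨ cong (λ y → lookup y d) eq ⟨
  lookup (flip d x) d  ≡⟨ lookup∘updateAt d x ⟩
  not (lookup x d)     ∎)

flip-both-ways : ∀ {k} (d d' : Fin k) x y → flip d x ≡ y → flip d' y ≡ x → d ≡ d'
flip-both-ways d d' x y p q = flip-direction-injective d d' x (begin
  flip d x                 ≡⟨ p ⟩
  y                        ≡⟨ sym (flip-involutive d' y) ⟩
  flip d' (flip d' y)      ≡⟨ cong (flip d') q ⟩
  flip d' x                ∎)

parity : ∀ {k} → Vec Bool k → Bool
parity []      = false
parity (b ∷ x) = b xor parity x

xor-cancelʳ : ∀ a b → (a xor b) xor b ≡ a
xor-cancelʳ a b = trans (xor-assoc a b b) (trans (cong (a xor_) (xor-same b)) (xor-identityʳ a))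

xor-swapˡ : ∀ a b c → a xor (b xor c) ≡ b xor (a xor c)
xor-swapˡ a b c = trans (sym (xor-assoc a b c)) (trans (cong (_xor c) (xor-comm a b)) (xor-assoc b a c))

parity-flip : ∀ {k} (d : Fin k) x → parity (flip d x) ≡ not (parity x)
parity-flip zero    (b ∷ x) = sym (not-distribˡ-xor b (parity x))
parity-flip (suc d) (b ∷ x) = trans (cong (b xor_) (parity-flip d x)) (sym (not-distribʳ-xor b (parity x)))

parity-insertAt : ∀ {k} (x : Vec Bool k) d a → parity (insertAt x d a) ≡ a xor parity x
parity-insertAt x       zero    a = refl
parity-insertAt (b ∷ x) (suc d) a = trans (cong (b xor_) (parity-insertAt x d a)) (xor-swapˡ b a (parity x))

parity-removeAt : ∀ {k} (x : Vec Bool (suc k)) d → parity x ≡ lookup x d xor parity (removeAt x d)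
parity-removeAt x d =
  trans (cong parity (sym (insertAt-removeAt x d))) (parity-insertAt (removeAt x d) d (lookup x d))

parity-tail-determines : ∀ {k} (x : Vec Bool (suc k)) → (parity x xor parity (tail x)) ∷ tail x ≡ x
parity-tail-determines (b ∷ x) = cong (_∷ x) (xor-cancelʳ b (parity x))

-- The hypercube graph

Adjacent : ∀ {k} → Vec Bool k → Vec Bool k → Set
Adjacent x y = ∃ λ d → y ≡ flip d x

adjacent? : ∀ {k} (x y : Vec Bool k) → Dec (Adjacent x y)
adjacent? x y = any? (λ d → ≡-dec _≟_ y (flip d x))

adjacent-sym : ∀ {k} {x y : Vec Bool k} → Adjacent x y → Adjacent y x
adjacent-sym {x = x} (d , refl) = d , sym (flip-involutive d x)

adjacent-irrefl : ∀ {k} (x : Vec Bool k) → ¬ Adjacent x x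
adjacent-irrefl x (d , eq) = flip-changes d x (sym eq)

hypercube : ∀ k → GraphOn (Vec Bool k)
hypercube k = record
  { adjOn        = λ x y → does (adjacent? x y)
  ; adjOn-sym    = adjOn-sym′
  ; adjOn-irrefl = λ x → dec-false (adjacent? x x) (adjacent-irrefl x) }
  where
  adjOn-sym′ : ∀ x y → does (adjacent? x y) ≡ does (adjacent? y x)
  adjOn-sym′ x y with adjacent? x y
  ... | yes a = sym (dec-true (adjacent? y x) (adjacent-sym a))
  ... | no ¬a = sym (dec-false (adjacent? y x) (¬a ∘ adjacent-sym))

hypercube-edge : ∀ {k} (d : Fin k) x → IsEdgeOn (hypercube k) (x , flip d x)
hypercube-edge d x = dec-true (adjacent? x (flip d x)) (d , refl)

hypercube-edge-sound : ∀ {k} x y → IsEdgeOn (hypercube k) (x , y) → Adjacent x y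
hypercube-edge-sound x y with adjacent? x y
... | yes a = λ _ → a
... | no _  = λ ()

lower-endpoint : ∀ {k} (d : Fin k) x →
                 ∃ λ y → lookup y d ≡ false × SameEdgeOn (x , flip d x) (y , flip d y)
lower-endpoint d x with lookup x d in eq
... | false = x , eq , inj₁ (refl , refl)
... | true  = flip d x , trans (lookup∘updateAt d x) (cong not eq)
            , inj₂ (sym (flip-involutive d x) , refl)

module Cube (m : ℕ) where
  k : ℕ
  k = suc (suc m)

  -- The vertex with coordinate d equal to 0 and parity b whose other
  -- coordinates are (c ∷ w), the bit c being forced by the parity.
  lower : Fin k → Bool → Vec Bool m → Vec Bool k
  lower d b w = insertAt ((b xor parity w) ∷ w) d false

  lower-lookup : ∀ d b w → lookup (lower d b w) d ≡ false
  lower-lookup d b w = insertAt-lookup _ d false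

  lower-parity : ∀ d b w → parity (lower d b w) ≡ b
  lower-parity d b w = trans (parity-insertAt _ d false) (xor-cancelʳ b (parity w))

  lower-injective : ∀ d b b' w w' → lower d b w ≡ lower d b' w' → w ≡ w'
  lower-injective d b b' w w' eq = ∷-injectiveʳ (begin
    (b xor parity w) ∷ w                    ≡⟨ sym (removeAt-insertAt _ d false) ⟩
    removeAt (lower d b w) d                ≡⟨ cong (λ x → removeAt x d) eq ⟩
    removeAt (lower d b' w') d              ≡⟨ removeAt-insertAt _ d false ⟩
    (b' xor parity w') ∷ w'                 ∎)

  lower-complete : ∀ d x → lookup x d ≡ false → lower d (parity x) (tail (removeAt x d)) ≡ x
  lower-complete d x eq = begin
    insertAt ((parity x xor parity w) ∷ w) d false ≡⟨ cong (λ b → insertAt ((b xor parity w) ∷ w) d false) parity-rest ⟩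
    insertAt ((parity r xor parity w) ∷ w) d false ≡⟨ cong (λ y → insertAt y d false) (parity-tail-determines r) ⟩
    insertAt r d false                             ≡⟨ cong (insertAt r d) (sym eq) ⟩
    insertAt r d (lookup x d)                      ≡⟨ insertAt-removeAt x d ⟩
    x                                              ∎
    where
    r = removeAt x d
    w = tail r
    parity-rest : parity x ≡ parity r
    parity-rest = trans (parity-removeAt x d) (cong (_xor parity r) eq)

  label : Fin k → Vec Bool k → Bool
  label d x = parity (x [ d ]≔ false)

  lower-cleared : ∀ d b w → lower d b w [ d ]≔ false ≡ lower d b w
  lower-cleared d b w = updateAt-id-local d (lower d b w) (sym (lower-lookup d b w))

  label-flip-other : ∀ d j x → j ≢ d → label d (flip j x) ≡ not (label d x)
  label-flip-other d j x j≢d =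
    trans (cong parity (updateAt-commutes d j (j≢d ∘ sym) x)) (parity-flip j (x [ d ]≔ false))

  -- Matchings are indexed by a label and a direction, their edges by the
  -- free bits of the lower endpoint.
  Label×Direction : Set
  Label×Direction = Bool × Fin k

  M : Label×Direction → Vec Bool m → Vec Bool k × Vec Bool k
  M (b , d) w = lower d b w , flip d (lower d b w)

  covered-clear : ∀ b d w x → CoversOn (M (b , d) w) x → x [ d ]≔ false ≡ lower d b w
  covered-clear b d w x (inj₁ refl) = lower-cleared d b w
  covered-clear b d w x (inj₂ refl) = trans (updateAt-updateAt d (lower d b w)) (lower-cleared d b w)

  covered-label : ∀ b d w x → CoversOn (M (b , d) w) x → label d x ≡ b
  covered-label b d w x c = trans (cong parity (covered-clear b d w x c)) (lower-parity d b w)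

  other-direction-leaves : ∀ b d j x → j ≢ d → label d x ≡ b → ¬ label d (flip j x) ≡ b
  other-direction-leaves b d j x j≢d lx ly =
    not-¬ refl (trans (sym ly) (trans (label-flip-other d j x j≢d) (cong not lx)))

  -- M(b,d) is an induced matching: a covered vertex determines the lower
  -- endpoint of its edge, and an edge between covered vertices must be a
  -- d-edge by other-direction-leaves.
  induced : ∀ i → IsInducedMatchingOn (hypercube k) (M i)
  induced (b , d) = edges , vertexDisjoint , closed
    where
    edges : ∀ w → IsEdgeOn (hypercube k) (M (b , d) w)
    edges w = hypercube-edge d (lower d b w)

    vertexDisjoint : ∀ w w' x → CoversOn (M (b , d) w) x → CoversOn (M (b , d) w') x → w ≡ w'
    vertexDisjoint w w' x c c' =
      lower-injective d b b w w' (trans (sym (covered-clear b d w x c)) (covered-clear b d w' x c'))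

    closed : ∀ x y → (∃ λ w → CoversOn (M (b , d) w) x) → (∃ λ w → CoversOn (M (b , d) w) y) →
             IsEdgeOn (hypercube k) (x , y) → ∃ λ w → SameEdgeOn (x , y) (M (b , d) w)
    closed x y (w , c) (w' , c') e with hypercube-edge-sound x y e
    ... | j , refl with j ≟ᶠ d
    ... | no j≢d with () ← other-direction-leaves b d j x j≢d (covered-label b d w x c)
                               (covered-label b d w' (flip j x) c')
    ... | yes refl with c
    ... | inj₁ refl = w , inj₁ (refl , refl)
    ... | inj₂ refl = w , inj₂ (refl , flip-involutive d _)

  lower-not-upper : ∀ d b b' w w' → lower d b w ≢ flip d (lower d b' w')
  lower-not-upper d b b' w w' eq = not-¬ refl (begin
    false                               ≡⟨ sym (lower-lookup d b w) ⟩
    lookup (lower d b w) d              ≡⟨ cong (λ x → lookup x d) eq ⟩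
    lookup (flip d (lower d b' w')) d   ≡⟨ lookup∘updateAt d (lower d b' w') ⟩
    not (lookup (lower d b' w') d)      ≡⟨ cong not (lower-lookup d b' w') ⟩
    not false                           ∎)

  disjoint : ∀ i i' w w' → SameEdgeOn (M i w) (M i' w') → (i ≡ i') × (w ≡ w')
  disjoint (b , d) (b' , d') w w' (inj₁ (p , q))
    with refl ← flip-direction-injective d d' (lower d b w) (trans q (cong (flip d') (sym p)))
    with refl ← trans (sym (lower-parity d b w)) (trans (cong parity p) (lower-parity d b' w'))
    = refl , lower-injective d b b w w' p
  disjoint (b , d) (b' , d') w w' (inj₂ (p , q))
    with refl ← flip-both-ways d d' (lower d b w) (lower d' b' w') q (sym p)
    with () ← lower-not-upper d b b' w w' p

  -- A d-edge lies in the matching given by d and the parity of its lower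
  -- endpoint.
  covering : ∀ x y → IsEdgeOn (hypercube k) (x , y) →
             ∃ λ i → ∃ λ w → SameEdgeOn (x , y) (M i w)
  covering x y e with hypercube-edge-sound x y e
  ... | d , refl with lower-endpoint d x
  ... | z , z-lower , s =
    (parity z , d) , tail (removeAt z d) ,
    subst (λ u → SameEdgeOn (x , flip d x) (u , flip d u)) (sym (lower-complete d z z-lower)) s

  hypercube-RS : IsRSOn (Vec Bool m) Label×Direction (hypercube k)
  hypercube-RS = M , induced , disjoint , covering

bits↔Fin : ∀ n → Vec Bool n ↔ Fin (2 ^ n)
bits↔Fin zero    = mk↔ₛ′ (λ _ → zero) (λ _ → []) (λ { zero → refl }) (λ { [] → refl })
bits↔Fin (suc n) = ↔-sym *↔× ↔-∘ ((↔-sym 2↔Bool ×-↔ bits↔Fin n) ↔-∘ uncons)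
  where
  uncons : Vec Bool (suc n) ↔ (Bool × Vec Bool n)
  uncons = mk↔ₛ′ (λ { (b ∷ x) → b , x }) (λ (b , x) → b ∷ x) (λ _ → refl) (λ { (b ∷ x) → refl })

labelDirection↔Fin : ∀ k → (Bool × Fin k) ↔ Fin (2 * k)
labelDirection↔Fin k = ↔-sym *↔× ↔-∘ (↔-sym 2↔Bool ×-↔ ↔-id (Fin k))

quarter : ∀ m → 2 ^ m ≡ 2 ^ suc (suc m) / 4
quarter m = sym (trans (cong (_/ 4) four-times) (m*n/n≡m (2 ^ m) 4))
  where
  four-times : 2 * (2 * 2 ^ m) ≡ 2 ^ m * 4
  four-times = trans (sym (*-assoc 2 2 (2 ^ m))) (*-comm 4 (2 ^ m))

proposition3p1 : (k : ℕ) → 2 ≤ k →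
    Σ (Graph (2 ^ k)) λ G → IsRuzsaSzemeredi ((2 ^ k) / 4) (2 * k) G
proposition3p1 (suc (suc m)) (s≤s (s≤s _)) =
  subst (λ r → Σ (Graph (2 ^ k)) (IsRuzsaSzemeredi r (2 * k))) (quarter m)
    (relabel (bits↔Fin k) (hypercube k)
      (reindex {G = hypercube k} (labelDirection↔Fin k) (bits↔Fin m) hypercube-RS))
  where open Cube m
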